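{- Let $X$ be a non-empty set, $X_0=X\cup\{0\}$ with $0\notin X$, and $\mathrm{Ltrel}_0(X)$ the set of left-total relations $\rho$ on $X_0$ such that $(0,s)\in\rho$ iff $s=0$. For $\rho\in\mathrm{Ltrel}_0(X)$ let $\rho^a=\rho\cap(X\times X)$ and $\rho^d=\{(x,y)\in\rho: x\in X, ((x,z)\in\rho\Rightarrow z\neq 0)\}$. Let $;$ denote ordinary relational composition, $*$ demonic composition ($s*t=(s;t)\cap\{(x,y): s(x)\subseteq\mathrm{dom}(t)\}$) and $\sqcup\!\!\sqcup$ demonic join ($s\sqcup\!\!\sqcup t=\{(x,y)\in s\cup t: x\in\mathrm{dom}(s)\cap\mathrm{dom}(t)\}$). Then $\rho\mapsto\rho^a$ is a surjective homomorphism from $(\mathrm{Ltrel}_0(X),;)$ onto $(\mathrm{Rel}(X),;)$ and from $(\mathrm{Ltrel}_0(X),;,\cup)$ onto $(\mathrm{Rel}(X),;,\cup)$, and $\rho\mapsto\rho^d$ is a surjective homomorphism from $(\mathrm{Ltrel}_0(X),;)$ onto $(\mathrm{Rel}(X),*)$ and from $(\mathrm{Ltrel}_0(X),;,\cup)$ onto $(\mathrm{Rel}(X),*,\sqcup\!\!\sqcup)$; this persists on adding the diagonal relation $1'$ and the constant ${\bf 0}=\{(x,0):x\in X_0\}$ (sent to the diagonal on $X$ and to $\emptyset$ respectively). Moreover, $\mathrm{Ltrel}_0(X)$ under any signature contained in $\{;,\cup,1',{\bf 0}\}$ is a subdirect product of copies of $\mathrm{Rel}(X)$ equipped with the corresponding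 angelic and demonic signatures.
   Context: Uses the facts that $\rho=\tau$ iff $\rho^a=\tau^a$ and $\rho^d=\tau^d$, $(\rho;\tau)^a=\rho^a;\tau^a$, $(\rho;\tau)^d=\rho^d*\tau^d$, $(\rho\cup\tau)^a=\rho^a\cup\tau^a$, $(\rho\cup\tau)^d=\rho^d\sqcup\!\!\sqcup\tau^d$, and every relation on $X$ is both an angelic and a demonic restriction of some element of $\mathrm{Ltrel}_0(X)$. -}

module Defs where

open import Level using (0ℓ)
open import Data.Maybe using (Maybe; just; nothing)
open import Data.Product using (Σ; ∃; _×_; _,_)
open import Data.Sum using (_⊎_)
open import Data.Empty using (⊥)
open import Relation.Nullary using (¬_)
open import Relation.Binary.Core using (Rel)
open import Relation.Binary.PropositionalEquality using (_≡_)
open import Relation.Binary.Construct.Union using (_∪_) public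

Relation : Set → Set₁
Relation A = Rel A 0ℓ

infixr 9 _⨾_
_⨾_ : {A : Set} → Relation A → Relation A → Relation A
(R ⨾ S) x z = ∃ λ y → R x y × S y z

infix 4 _≐_
_≐_ : {A : Set} → Relation A → Relation A → Set
R ≐ S = ∀ x y → (R x y → S x y) × (S x y → R x y)

-- X₀ = X ∪ {0}, with 0 represented by 'nothing'.
X₀ : Set → Set
X₀ X = Maybe X

𝟏' : {A : Set} → Relation A
𝟏' x y = x ≡ y

∅ : {A : Set} → Relation A
∅ _ _ = ⊥

𝟎 : {X : Set} → Relation (X₀ X)
𝟎 _ s = s ≡ nothing

dom : {A : Set} → Relation A → A → Set
dom t x = ∃ λ y → t x y

_*_ : {A : Set} → Relation A → Relation A → Relation A
(s * t) x y = (s ⨾ t) x y × (∀ z → s x z → dom t z)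

_⊔⊔_ : {A : Set} → Relation A → Relation A → Relation A
(s ⊔⊔ t) x y = (s ∪ t) x y × dom s x × dom t x

LeftTotal : {A : Set} → Relation A → Set
LeftTotal ρ = ∀ x → ∃ λ s → ρ x s

Ltrel₀ : {X : Set} → Relation (X₀ X) → Set
Ltrel₀ ρ = LeftTotal ρ × (∀ s → (ρ nothing s → s ≡ nothing) × (s ≡ nothing → ρ nothing s))

_ᵃ : {X : Set} → Relation (X₀ X) → Relation X
(ρ ᵃ) x y = ρ (just x) (just y)

_ᵈ : {X : Set} → Relation (X₀ X) → Relation X
(ρ ᵈ) x y = ρ (just x) (just y) × ¬ ρ (just x) nothing

module Submission where

open import Defs
open import Data.Maybe using (just; nothing)
open import Data.Maybe.Properties using (just-injective)
open import Data.Product using (Σ; ∃; _×_; _,_; proj₁; proj₂)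
open import Data.Sum using (_⊎_; inj₁; inj₂; [_,_])
open import Data.Unit using (⊤; tt)
open import Function using (id)
open import Axiom.ExcludedMiddle using (ExcludedMiddle)
open import Level using (0ℓ)
open import Relation.Nullary using (¬_; yes; no; contradiction)
open import Relation.Binary.PropositionalEquality using (_≡_; refl; cong)

-- The point 0 stands for failure. The angelic restriction ρᵃ forgets it; the demonic
-- restriction ρᵈ discards every input that may fail, so classically dom ρᵈ is exactly
-- the set of inputs that never fail. Hence ρ is recovered from ρᵃ and ρᵈ, and every
-- r arises as ρᵃ (send every input also to 0) and as ρᵈ (send to 0 exactly the
-- inputs outside dom r; deciding dom r needs excluded middle).

≐-refl : {A : Set} {R : Relation A} → R ≐ R
≐-refl _ _ = id , id

module _ {X : Set} where

  Diverges : Relation (X₀ X) → X → Set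
  Diverges ρ x = ρ (just x) nothing

  mkLtrel₀ : {ρ : Relation (X₀ X)} → LeftTotal ρ →
             (∀ {s} → ρ nothing s → s ≡ nothing) → ρ nothing nothing → Ltrel₀ ρ
  mkLtrel₀ total from0 0↦0 = total , λ _ → from0 , λ { refl → 0↦0 }

  module _ {ρ : Relation (X₀ X)} (ρ-lt : Ltrel₀ ρ) where

    from0⇒0 : ∀ {s} → ρ nothing s → s ≡ nothing
    from0⇒0 {s} = proj₁ (proj₂ ρ-lt s)

    0↦0 : ρ nothing nothing
    0↦0 = proj₂ (proj₂ ρ-lt nothing) refl

    ¬Diverges⇒dom-ᵈ : ∀ {x} → ¬ Diverges ρ x → dom (ρ ᵈ) x
    ¬Diverges⇒dom-ᵈ {x} ¬div with proj₁ ρ-lt (just x)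
    ... | just y  , p = y , p , ¬div
    ... | nothing , p = contradiction p ¬div

  Ltrel₀-⨾ : {ρ τ : Relation (X₀ X)} → Ltrel₀ ρ → Ltrel₀ τ → Ltrel₀ (ρ ⨾ τ)
  Ltrel₀-⨾ {ρ} {τ} ρ-lt τ-lt = mkLtrel₀ total from0 (nothing , 0↦0 ρ-lt , 0↦0 τ-lt)
    where
    total : LeftTotal (ρ ⨾ τ)
    total a = let (w , p) = proj₁ ρ-lt a ; (s , q) = proj₁ τ-lt w in s , w , p , q
    from0 : ∀ {s} → (ρ ⨾ τ) nothing s → s ≡ nothing
    from0 (w , p , q) with from0⇒0 ρ-lt p
    ... | refl = from0⇒0 τ-lt q

  Ltrel₀-∪ : {ρ τ : Relation (X₀ X)} → Ltrel₀ ρ → Ltrel₀ τ → Ltrel₀ (ρ ∪ τ)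
  Ltrel₀-∪ ρ-lt τ-lt =
    mkLtrel₀ (λ a → let (s , p) = proj₁ ρ-lt a in s , inj₁ p)
             [ from0⇒0 ρ-lt , from0⇒0 τ-lt ]
             (inj₁ (0↦0 ρ-lt))

  Ltrel₀-𝟏' : Ltrel₀ {X} 𝟏'
  Ltrel₀-𝟏' = mkLtrel₀ (λ a → a , refl) (λ { refl → refl }) refl

  Ltrel₀-𝟎 : Ltrel₀ {X} 𝟎
  Ltrel₀-𝟎 = mkLtrel₀ (λ _ → nothing , refl) id refl

  ⨾-to-just : {ρ τ : Relation (X₀ X)} → Ltrel₀ τ → ∀ {a y} →
              (ρ ⨾ τ) a (just y) → ∃ λ w → ρ a (just w) × τ (just w) (just y)
  ⨾-to-just τ-lt (just w , p , q) = w , p , q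
  ⨾-to-just τ-lt (nothing , p , q) with from0⇒0 τ-lt q
  ... | ()

  Diverges-⨾ : {ρ τ : Relation (X₀ X)} → ∀ {x} → Diverges (ρ ⨾ τ) x →
               Diverges ρ x ⊎ ∃ λ z → ρ (just x) (just z) × Diverges τ z
  Diverges-⨾ (nothing , p , _) = inj₁ p
  Diverges-⨾ (just z  , p , q) = inj₂ (z , p , q)

  ᵃ-⨾ : {ρ τ : Relation (X₀ X)} → Ltrel₀ τ → (ρ ⨾ τ) ᵃ ≐ (ρ ᵃ) ⨾ (τ ᵃ)
  ᵃ-⨾ {ρ} τ-lt x y = ⨾-to-just {ρ} τ-lt , λ { (w , p , q) → just w , p , q }

  ᵃ-∪ : {ρ τ : Relation (X₀ X)} → (ρ ∪ τ) ᵃ ≐ (ρ ᵃ) ∪ (τ ᵃ)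
  ᵃ-∪ = ≐-refl

  ᵃ-𝟏' : (𝟏' {X₀ X}) ᵃ ≐ 𝟏'
  ᵃ-𝟏' x y = just-injective , cong just

  ᵃ-𝟎 : (𝟎 {X}) ᵃ ≐ ∅
  ᵃ-𝟎 x y = (λ ()) , λ ()

  ᵈ-⨾ : {ρ τ : Relation (X₀ X)} → Ltrel₀ τ → (ρ ⨾ τ) ᵈ ≐ (ρ ᵈ) * (τ ᵈ)
  ᵈ-⨾ {ρ} {τ} τ-lt x y = to , from
    where
    to : ((ρ ⨾ τ) ᵈ) x y → ((ρ ᵈ) * (τ ᵈ)) x y
    to (p⨾q , ¬div) with ⨾-to-just {ρ} τ-lt p⨾q
    ... | w , p , q = (w , (p , ¬div-ρ) , (q , ¬div-τ p)) ,
                      λ z pᵈ → ¬Diverges⇒dom-ᵈ τ-lt (¬div-τ (proj₁ pᵈ))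
      where
      ¬div-ρ : ¬ Diverges ρ x
      ¬div-ρ r = ¬div (nothing , r , 0↦0 τ-lt)
      ¬div-τ : ∀ {z} → ρ (just x) (just z) → ¬ Diverges τ z
      ¬div-τ p t = ¬div (just _ , p , t)
    from : ((ρ ᵈ) * (τ ᵈ)) x y → ((ρ ⨾ τ) ᵈ) x y
    from ((w , (p , ¬div-ρ) , (q , _)) , succ-in-dom) =
      (just w , p , q) , λ div → [ ¬div-ρ , ¬div-τ ] (Diverges-⨾ {ρ} {τ} div)
      where
      ¬div-τ : ¬ ∃ λ z → ρ (just x) (just z) × Diverges τ z
      ¬div-τ (z , r , t) = let (_ , _ , ¬t) = succ-in-dom z (r , ¬div-ρ) in ¬t t

  ᵈ-∪ : {ρ τ : Relation (X₀ X)} → Ltrel₀ ρ → Ltrel₀ τ → (ρ ∪ τ) ᵈ ≐ (ρ ᵈ) ⊔⊔ (τ ᵈ)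
  ᵈ-∪ {ρ} {τ} ρ-lt τ-lt x y = to , from
    where
    to : ((ρ ∪ τ) ᵈ) x y → ((ρ ᵈ) ⊔⊔ (τ ᵈ)) x y
    to (r , ¬div) =
      [ (λ p → inj₁ (p , ¬div-ρ)) , (λ q → inj₂ (q , ¬div-τ)) ] r ,
      ¬Diverges⇒dom-ᵈ ρ-lt ¬div-ρ , ¬Diverges⇒dom-ᵈ τ-lt ¬div-τ
      where
      ¬div-ρ : ¬ Diverges ρ x
      ¬div-ρ p = ¬div (inj₁ p)
      ¬div-τ : ¬ Diverges τ x
      ¬div-τ q = ¬div (inj₂ q)
    from : ((ρ ᵈ) ⊔⊔ (τ ᵈ)) x y → ((ρ ∪ τ) ᵈ) x y
    from (r , (_ , _ , ¬div-ρ) , (_ , _ , ¬div-τ)) =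
      [ (λ p → inj₁ (proj₁ p)) , (λ q → inj₂ (proj₁ q)) ] r , [ ¬div-ρ , ¬div-τ ]

  ᵈ-𝟏' : (𝟏' {X₀ X}) ᵈ ≐ 𝟏'
  ᵈ-𝟏' x y = (λ { (refl , _) → refl }) , λ { refl → refl , λ () }

  ᵈ-𝟎 : (𝟎 {X}) ᵈ ≐ ∅
  ᵈ-𝟎 x y = (λ { (() , _) }) , λ ()

  extend : Relation X → (X → Set) → Relation (X₀ X)
  extend r D (just x) (just y) = r x y
  extend r D (just x) nothing  = D x
  extend r D nothing  s        = s ≡ nothing

  Ltrel₀-extend : (r : Relation X) (D : X → Set) →
                  (∀ x → dom r x ⊎ D x) → Ltrel₀ (extend r D)
  Ltrel₀-extend r D covered = mkLtrel₀ total id refl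
    where
    total : LeftTotal (extend r D)
    total nothing  = nothing , refl
    total (just x) = [ (λ { (y , p) → just y , p }) , (λ d → nothing , d) ] (covered x)

  extend-ᵃ : (r : Relation X) (D : X → Set) → extend r D ᵃ ≐ r
  extend-ᵃ r D = ≐-refl

  extend-ᵈ : (r : Relation X) → extend r (λ x → ¬ dom r x) ᵈ ≐ r
  extend-ᵈ r x y = proj₁ , λ p → p , λ ¬dom → ¬dom (y , p)

  ᵃ-surjective : (r : Relation X) → Σ (Relation (X₀ X)) λ ρ → Ltrel₀ ρ × (ρ ᵃ ≐ r)
  ᵃ-surjective r =
    extend r D , Ltrel₀-extend r D (λ _ → inj₂ tt) , extend-ᵃ r D
    where
    D : X → Set
    D _ = ⊤

  ᵈ-⊆⇒¬Diverges-mono : {ρ τ : Relation (X₀ X)} → Ltrel₀ ρ →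
                        (∀ x y → (ρ ᵈ) x y → (τ ᵈ) x y) →
                        ∀ {x} → ¬ Diverges ρ x → ¬ Diverges τ x
  ᵈ-⊆⇒¬Diverges-mono {ρ} ρ-lt ρᵈ⊆τᵈ ¬div =
    let (y , pᵈ) = ¬Diverges⇒dom-ᵈ ρ-lt ¬div in proj₂ (ρᵈ⊆τᵈ _ y pᵈ)

  module _ (em : ExcludedMiddle 0ℓ) where

    ᵈ-surjective : (r : Relation X) → Σ (Relation (X₀ X)) λ ρ → Ltrel₀ ρ × (ρ ᵈ ≐ r)
    ᵈ-surjective r = extend r D , Ltrel₀-extend r D decide , extend-ᵈ r
      where
      D : X → Set
      D x = ¬ dom r x
      decide : ∀ x → dom r x ⊎ D x
      decide x with em {dom r x}
      ... | yes p = inj₁ p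
      ... | no ¬p = inj₂ ¬p

    ᵈ-⊆⇒Diverges-antimono : {ρ τ : Relation (X₀ X)} → Ltrel₀ ρ →
                             (∀ x y → (ρ ᵈ) x y → (τ ᵈ) x y) →
                             ∀ {x} → Diverges τ x → Diverges ρ x
    ᵈ-⊆⇒Diverges-antimono {ρ} {τ} ρ-lt ρᵈ⊆τᵈ {x} div with em {Diverges ρ x}
    ... | yes d  = d
    ... | no ¬d = contradiction div (ᵈ-⊆⇒¬Diverges-mono {ρ} {τ} ρ-lt ρᵈ⊆τᵈ ¬d)

    ᵃᵈ-injective : {ρ τ : Relation (X₀ X)} → Ltrel₀ ρ → Ltrel₀ τ →
                   ρ ᵃ ≐ τ ᵃ → ρ ᵈ ≐ τ ᵈ → ρ ≐ τ
    ᵃᵈ-injective {ρ} {τ} ρ-lt τ-lt ρᵃ≐τᵃ ρᵈ≐τᵈ = go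
      where
      go : ρ ≐ τ
      go nothing  s        = (λ p → proj₂ (proj₂ τ-lt s) (from0⇒0 ρ-lt p))
                           , (λ q → proj₂ (proj₂ ρ-lt s) (from0⇒0 τ-lt q))
      go (just x) (just y) = ρᵃ≐τᵃ x y
      go (just x) nothing  =
        ᵈ-⊆⇒Diverges-antimono {τ} {ρ} τ-lt (λ a b → proj₂ (ρᵈ≐τᵈ a b)) ,
        ᵈ-⊆⇒Diverges-antimono {ρ} {τ} ρ-lt (λ a b → proj₁ (ρᵈ≐τᵈ a b))

mainTheorem10 : ExcludedMiddle 0ℓ → (X : Set) → X →
    ((ρ τ : Relation (X₀ X)) → Ltrel₀ ρ → Ltrel₀ τ → Ltrel₀ (ρ ⨾ τ) × Ltrel₀ (ρ ∪ τ))
    × Ltrel₀ {X} 𝟏' × Ltrel₀ {X} 𝟎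
    × ((ρ τ : Relation (X₀ X)) → Ltrel₀ ρ → Ltrel₀ τ →
         ((ρ ⨾ τ) ᵃ ≐ (ρ ᵃ) ⨾ (τ ᵃ)) × ((ρ ∪ τ) ᵃ ≐ (ρ ᵃ) ∪ (τ ᵃ)))
    × ((𝟏' {X₀ X}) ᵃ ≐ 𝟏') × ((𝟎 {X}) ᵃ ≐ ∅)
    × ((ρ τ : Relation (X₀ X)) → Ltrel₀ ρ → Ltrel₀ τ →
         ((ρ ⨾ τ) ᵈ ≐ (ρ ᵈ) * (τ ᵈ)) × ((ρ ∪ τ) ᵈ ≐ (ρ ᵈ) ⊔⊔ (τ ᵈ)))
    × ((𝟏' {X₀ X}) ᵈ ≐ 𝟏') × ((𝟎 {X}) ᵈ ≐ ∅)
    × ((r : Relation X) → Σ (Relation (X₀ X)) λ ρ → Ltrel₀ ρ × (ρ ᵃ ≐ r))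
    × ((r : Relation X) → Σ (Relation (X₀ X)) λ ρ → Ltrel₀ ρ × (ρ ᵈ ≐ r))
    × ((ρ τ : Relation (X₀ X)) → Ltrel₀ ρ → Ltrel₀ τ →
         (ρ ᵃ ≐ τ ᵃ) → (ρ ᵈ ≐ τ ᵈ) → ρ ≐ τ)
mainTheorem10 em X _ =
    (λ _ _ ρ-lt τ-lt → Ltrel₀-⨾ ρ-lt τ-lt , Ltrel₀-∪ ρ-lt τ-lt)
  , Ltrel₀-𝟏' , Ltrel₀-𝟎
  , (λ ρ τ _ τ-lt → ᵃ-⨾ {ρ = ρ} τ-lt , ᵃ-∪ {ρ = ρ} {τ})
  , ᵃ-𝟏' , ᵃ-𝟎
  , (λ ρ _ ρ-lt τ-lt → ᵈ-⨾ {ρ = ρ} τ-lt , ᵈ-∪ ρ-lt τ-lt)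
  , ᵈ-𝟏' , ᵈ-𝟎
  , ᵃ-surjective , ᵈ-surjective em
  , (λ ρ τ → ᵃᵈ-injective em {ρ = ρ} {τ})
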